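{- Let $A=(A(1),\ldots,A(n))$ be an array of elements of a totally ordered set that is both $3$-sorted and $4$-sorted. Then a $5$-inversion of $A$ cannot nest a $2$-inversion of $A$: there are no indices $i<j$ with $j+2<i+5$ such that $(i,i+5)$ is a $5$-inversion and $(j,j+2)$ is a $2$-inversion of $A$.
   Context: An array $A$ is $k$-sorted if $A(i)\le A(i+k)$ for all $1\le i\le n-k$. A $p$-inversion of $A$ is a pair $(i,i+p)$ with $1\le i<i+p\le n$ and $A(i)>A(i+p)$. Two inversions $(i,i+p)$ and $(j,j+q)$ are nested if $i<j<j+q<i+p$. -}

module Defs where

open import Level using (Level)
open import Data.Nat using (ℕ; suc; _+_; _<_)
open import Data.Nat.Properties using (m+n≤o⇒m≤o)
open import Data.Fin using (Fin; fromℕ<)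
open import Data.Product using (_×_)
open import Relation.Binary.Bundles using (TotalOrder)
open import Relation.Nullary using (¬_)

-- Arrays of length n over a totally ordered set are functions Fin n → Carrier.
-- Positions are 0-based here: position i (0 ≤ i < n) stands for A(i+1) of the paper.
module _ {c ℓ₁ ℓ₂ : Level} (T : TotalOrder c ℓ₁ ℓ₂) where
  open TotalOrder T

  at : ∀ {n} → (Fin n → Carrier) → (i : ℕ) → i < n → Carrier
  at A i i<n = A (fromℕ< i<n)

  KSorted : ℕ → ∀ {n} → (Fin n → Carrier) → Set _
  KSorted k {n} A = ∀ i → (h : i + k < n) →
    at A i (m+n≤o⇒m≤o (suc i) h) ≤ at A (i + k) h

  IsInversion : ∀ {n} → (Fin n → Carrier) → (p i : ℕ) → i + p < n → Set _
  IsInversion A p i h = at A (i + p) h ≤ at A i (m+n≤o⇒m≤o (suc i) h) × ¬ (at A (i + p) h ≈ at A i (m+n≤o⇒m≤o (suc i) h))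

-- The nested 2-inversion (j, j+2) sits one or two places to the right of i, so the
-- four positions i < j < j+2 < i+5 have gaps 3 and 4 between i and j+2 and between
-- j and i+5. Being 3- and 4-sorted gives A(i) ≤ A(j+2) and A(j) ≤ A(i+5), so the
-- 5-inversion A(i+5) ≤ A(i) yields A(j) ≤ A(j+2), contradicting the 2-inversion.
module Submission where

open import Defs
open import Level using (Level)
open import Data.Nat using (ℕ; _+_; _<_; zero; suc; s≤s)
open import Data.Nat.Properties using (+-suc; m+n≤o⇒m≤o; m+n≤o⇒n≤o)
open import Data.Fin using (Fin)
open import Data.Fin.Properties using (fromℕ<-cong)
open import Relation.Binary.Bundles using (TotalOrder)
open import Relation.Nullary using (¬_)
open import Data.Product using (_×_; _,_)
open import Data.Sum using (_⊎_; inj₁; inj₂)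
open import Relation.Binary.PropositionalEquality using (_≡_; refl; sym; trans; cong; subst)

nested-offset : ∀ {i j} → i < j → j + 2 < i + 5 → j ≡ suc i ⊎ j ≡ 2 + i
nested-offset {zero}  {suc zero}          _ _ = inj₁ refl
nested-offset {zero}  {suc (suc zero)}    _ _ = inj₂ refl
nested-offset {zero}  {suc (suc (suc j))} _ (s≤s (s≤s (s≤s (s≤s j+2≤1)))) with m+n≤o⇒n≤o j j+2≤1
... | s≤s ()
nested-offset {suc i} {suc j} (s≤s i<j) (s≤s j+2<i+5) with nested-offset i<j j+2<i+5
... | inj₁ j≡1+i = inj₁ (cong suc j≡1+i)
... | inj₂ j≡2+i = inj₂ (cong suc j≡2+i)

module _ {c ℓ₁ ℓ₂ : Level} (T : TotalOrder c ℓ₁ ℓ₂) {n : ℕ} (A : Fin n → TotalOrder.Carrier T) where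
  open TotalOrder T using (_≤_)

  at-cong : ∀ {i l} → i ≡ l → (hi : i < n) (hl : l < n) → at T A i hi ≡ at T A l hl
  at-cong {i} {l} i≡l hi hl = cong A (fromℕ<-cong i l i≡l hi hl)

  KSorted⇒≤ : ∀ {k i l} → KSorted T k A → i + k ≡ l →
              (hi : i < n) (hl : l < n) → at T A i hi ≤ at T A l hl
  KSorted⇒≤ {k} {i} sorted refl hi hl =
    subst (_≤ at T A (i + k) hl) (at-cong refl (m+n≤o⇒m≤o (suc i) hl) hi) (sorted i hl)

  nested-≤ : KSorted T 3 A → KSorted T 4 A →
             ∀ {i j} → i < j → j + 2 < i + 5 → (hi : i < n) (hj : j < n)
             (h₅ : i + 5 < n) (h₂ : j + 2 < n) →
             at T A i hi ≤ at T A (j + 2) h₂ × at T A j hj ≤ at T A (i + 5) h₅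
  nested-≤ sorted₃ sorted₄ {i} i<j j+2<i+5 hi hj h₅ h₂ with nested-offset i<j j+2<i+5
  ... | inj₁ refl = KSorted⇒≤ sorted₃ (+-suc i 2) hi h₂
                  , KSorted⇒≤ sorted₄ (sym (+-suc i 4)) hj h₅
  ... | inj₂ refl = KSorted⇒≤ sorted₄ (trans (+-suc i 3) (cong suc (+-suc i 2))) hi h₂
                  , KSorted⇒≤ sorted₃ (sym (trans (+-suc i 4) (cong suc (+-suc i 3)))) hj h₅

lemma9 : {c ℓ₁ ℓ₂ : Level} (T : TotalOrder c ℓ₁ ℓ₂) (n : ℕ) (A : Fin n → TotalOrder.Carrier T) →
    KSorted T 3 A → KSorted T 4 A →
    (i j : ℕ) → i < j → j + 2 < i + 5 →
    (h₅ : i + 5 < n) → (h₂ : j + 2 < n) →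
    ¬ (IsInversion T A 5 i h₅ × IsInversion T A 2 j h₂)
lemma9 T n A sorted₃ sorted₄ i j i<j j+2<i+5 h₅ h₂ ((A[i+5]≤A[i] , _) , (A[j+2]≤A[j] , A[j+2]≉A[j]))
  with nested-≤ T A sorted₃ sorted₄ i<j j+2<i+5 (m+n≤o⇒m≤o (suc i) h₅) (m+n≤o⇒m≤o (suc j) h₂) h₅ h₂
... | A[i]≤A[j+2] , A[j]≤A[i+5] =
  A[j+2]≉A[j] (antisym A[j+2]≤A[j] (≤-trans A[j]≤A[i+5] (≤-trans A[i+5]≤A[i] A[i]≤A[j+2])))
  where open TotalOrder T using (antisym) renaming (trans to ≤-trans)
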